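{- Let $K$ be a field of characteristic zero and let $\Sigma_1,\dots,\Sigma_s\subseteq \overline{K}^r$ be sets admitting purely exponential parametrizations. Then $\Sigma_1\cup\dots\cup\Sigma_s$ also admits a purely exponential parametrization.
   Context: A purely exponential polynomial in $m$ variables is a function $f:\mathbb{Z}^m\to\overline{K}$, $f(\mathbf{x})=\sum_{j=1}^e a_j\lambda_1^{l_{1,j}(\mathbf{x})}\cdots\lambda_k^{l_{k,j}(\mathbf{x})}$ with $a_j,\lambda_i\in\overline{K}^*$ and linear forms $l_{i,j}$ with integer coefficients. A set $\Sigma\subseteq\overline{K}^r$ admits a purely exponential parametrization if $\Sigma=\mathbf{f}(\mathbb{Z}^m)$ for some $m\ge0$ and some map $\mathbf{f}=(f_1,\dots,f_r)$ whose components are purely exponential polynomials in $m$ variables. -}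

module Defs where

open import Level using (Level; _⊔_)
open import Algebra.Bundles using (CommutativeRing)
open import Data.Nat as ℕ using (ℕ; zero; suc)
open import Data.Integer as ℤ using (ℤ; +_; -[1+_])
open import Data.Fin using (Fin)
open import Data.List using (List; []; _∷_)
open import Data.Product using (Σ; ∃; ∃-syntax; _×_; _,_)
open import Relation.Nullary using (¬_)

record IsFieldCR {c ℓ} (R : CommutativeRing c ℓ) : Set (c ⊔ ℓ) where
  open CommutativeRing R
  field
    0≉1     : ¬ (0# ≈ 1#)
    inverse : ∀ x → ¬ (x ≈ 0#) → ∃[ y ] (x * y ≈ 1#)

module _ {c ℓ} (R : CommutativeRing c ℓ) where
  open CommutativeRing R

  natCast : ℕ → Carrier
  natCast zero    = 0#
  natCast (suc n) = 1# + natCast n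

  CharZero : Set ℓ
  CharZero = ∀ n → ¬ (natCast (suc n) ≈ 0#)

  -- evaluation of the monic polynomial X^(length cs) + Σ cs_i X^i
  -- (coefficient list cs in increasing degree) : Horner scheme
  evalMonic : List Carrier → Carrier → Carrier
  evalMonic []       x = 1#
  evalMonic (c ∷ cs) x = c + x * evalMonic cs x

  AlgClosed : Set (c ⊔ ℓ)
  AlgClosed = ∀ (c₀ : Carrier) (cs : List Carrier) →
              ∃[ x ] (evalMonic (c₀ ∷ cs) x ≈ 0#)

  _^ⁿ_ : Carrier → ℕ → Carrier
  x ^ⁿ zero  = 1#
  x ^ⁿ suc n = x * (x ^ⁿ n)

  record NonZeroElt : Set (c ⊔ ℓ) where
    constructor nz
    field
      val    : Carrier
      inv    : Carrier
      val*inv : val * inv ≈ 1#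

  _^ᶻ_ : NonZeroElt → ℤ → Carrier
  λ' ^ᶻ (+ n)      = NonZeroElt.val λ' ^ⁿ n
  λ' ^ᶻ -[1+ n ]   = NonZeroElt.inv λ' ^ⁿ (suc n)

  sumFin : (n : ℕ) → (Fin n → Carrier) → Carrier
  sumFin zero    f = 0#
  sumFin (suc n) f = f Fin.zero + sumFin n (λ i → f (Fin.suc i))
    where import Data.Fin as Fin

  prodFin : (n : ℕ) → (Fin n → Carrier) → Carrier
  prodFin zero    f = 1#
  prodFin (suc n) f = f Fin.zero * prodFin n (λ i → f (Fin.suc i))
    where import Data.Fin as Fin

  linForm : (m : ℕ) → (Fin m → ℤ) → (Fin m → ℤ) → ℤ
  linForm zero    a x = + 0
  linForm (suc m) a x = a Fin.zero ℤ.* x Fin.zero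
                        ℤ.+ linForm m (λ t → a (Fin.suc t)) (λ t → x (Fin.suc t))
    where import Data.Fin as Fin

  -- A purely exponential polynomial in m variables:
  --   f(x) = Σ_{j<e} a_j λ_1^{l_{1,j}(x)} ⋯ λ_k^{l_{k,j}(x)}
  -- with a_j, λ_i nonzero and l_{i,j} integer linear forms.
  record PExpPoly (m : ℕ) : Set (c ⊔ ℓ) where
    field
      e       : ℕ
      k       : ℕ
      coeff   : Fin e → Carrier
      coeff≉0 : ∀ j → ¬ (coeff j ≈ 0#)
      base    : Fin k → NonZeroElt
      form    : Fin k → Fin e → (Fin m → ℤ)

  evalPExp : ∀ {m} → PExpPoly m → (Fin m → ℤ) → Carrier
  evalPExp {m} f x =
    sumFin e (λ j → coeff j * prodFin k (λ i → base i ^ᶻ linForm m (form i j) x))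
    where open PExpPoly f

  AdmitsPExpParam : ∀ {p} (r : ℕ) → ((Fin r → Carrier) → Set p) → Set (c ⊔ ℓ ⊔ p)
  AdmitsPExpParam r S =
    ∃[ m ] Σ (Fin r → PExpPoly m) λ f →
      ∀ (v : Fin r → Carrier) →
        (S v → ∃[ x ] (∀ i → v i ≈ evalPExp (f i) x)) ×
        (∃[ x ] (∀ i → v i ≈ evalPExp (f i) x) → S v)

-- A union S ∪ T is parametrized by one extra integer variable t whose parity
-- selects the part: with f parametrizing S on ℤᵐ and g parametrizing T on ℤⁿ,
--   h(t, x, y) = ½(1 + (−1)ᵗ) f(x) + ½(1 − (−1)ᵗ) g(y)
-- equals f(x) for even t and g(y) for odd t, and it is again purely
-- exponential with base −1 and linear form t.
module Submission where

open import Defs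
open import Algebra.Bundles using (CommutativeRing; Monoid)
import Algebra.Properties.CommutativeSemigroup as CommSemigroupProperties
import Algebra.Properties.Monoid.Sum as MonoidSum
import Algebra.Properties.Ring as RingProperties
import Algebra.Properties.Semiring.Sum as SemiringSum
open import Data.Nat as ℕ using (ℕ; zero; suc)
open import Data.Integer as ℤ using (ℤ; 0ℤ; 1ℤ)
import Data.Integer.Properties as ℤₚ
open import Data.Fin using (Fin; zero; suc; splitAt; _↑ˡ_; _↑ʳ_)
open import Data.Vec.Functional using (_∷_; _++_; head; tail; replicate)
open import Data.Vec.Functional.Properties using (lookup-++ˡ; lookup-++ʳ)
open import Data.Product as Product using (∃-syntax; _,_; proj₁; proj₂)
open import Data.Sum as Sum using (_⊎_; inj₁; inj₂)
open import Function using (_∘_; id)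
open import Relation.Binary.PropositionalEquality as ≡ using (_≡_; _≗_; cong; cong₂)
open import Relation.Nullary using (¬_)

module _ {a ℓ} (M : Monoid a ℓ) where
  open Monoid M
  open MonoidSum M using (sum)

  sum-splitAt : ∀ m {n} (h : Fin m ⊎ Fin n → Carrier) →
                sum (h ∘ splitAt m) ≈ sum (h ∘ inj₁) ∙ sum (h ∘ inj₂)
  sum-splitAt zero    h = sym (identityˡ _)
  sum-splitAt (suc m) h =
    trans (∙-congˡ (sum-splitAt m (h ∘ Sum.map₁ suc))) (sym (assoc _ _ _))

module _ {c ℓ} (F : CommutativeRing c ℓ) where
  open CommutativeRing F hiding (zero)

  linForm-cong : ∀ m (a : Fin m → ℤ) {x y : Fin m → ℤ} → x ≗ y →
                 linForm F m a x ≡ linForm F m a y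
  linForm-cong zero    a x≗y = ≡.refl
  linForm-cong (suc m) a x≗y =
    cong₂ ℤ._+_ (cong (a zero ℤ.*_) (x≗y zero)) (linForm-cong m (tail a) (x≗y ∘ suc))

  linForm-zero : ∀ m (x : Fin m → ℤ) → linForm F m (replicate m 0ℤ) x ≡ 0ℤ
  linForm-zero zero    x = ≡.refl
  linForm-zero (suc m) x = ≡.trans (ℤₚ.+-identityˡ _) (linForm-zero m (tail x))

  linForm-splitAt : ∀ m n (h : Fin m ⊎ Fin n → ℤ) (x : Fin (m ℕ.+ n) → ℤ) →
    linForm F (m ℕ.+ n) (h ∘ splitAt m) x
      ≡ linForm F m (h ∘ inj₁) (x ∘ (_↑ˡ n)) ℤ.+ linForm F n (h ∘ inj₂) (x ∘ (m ↑ʳ_))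
  linForm-splitAt zero    n h x = ≡.sym (ℤₚ.+-identityˡ _)
  linForm-splitAt (suc m) n h x =
    ≡.trans (cong (λ y → h₀x₀ ℤ.+ y) (linForm-splitAt m n (h ∘ Sum.map₁ suc) (tail x)))
            (≡.sym (ℤₚ.+-assoc h₀x₀ _ _))
    where h₀x₀ : ℤ
          h₀x₀ = h (inj₁ zero) ℤ.* x zero

  open SemiringSum semiring using (sum; sum-cong-≋; sum-cong-≗; *-distribˡ-sum)
  open MonoidSum *-monoid using ()
    renaming (sum to product; sum-cong-≋ to product-cong-≋; sum-cong-≗ to product-cong-≗;
              sum-replicate-zero to product-replicate-one)
  open RingProperties ring using (-1*x≈-x; -‿involutive)
  open CommSemigroupProperties *-commutativeSemigroup using (x∙yz≈y∙xz)

  private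
    _^_ : NonZeroElt F → ℤ → Carrier
    _^_ = _^ᶻ_ F

  open NonZeroElt
  open import Relation.Binary.Reasoning.Setoid setoid

  sumFin≡sum : ∀ n (f : Fin n → Carrier) → sumFin F n f ≡ sum f
  sumFin≡sum zero    f = ≡.refl
  sumFin≡sum (suc n) f = cong (f zero +_) (sumFin≡sum n (tail f))

  prodFin≡product : ∀ n (f : Fin n → Carrier) → prodFin F n f ≡ product f
  prodFin≡product zero    f = ≡.refl
  prodFin≡product (suc n) f = cong (f zero *_) (prodFin≡product n (tail f))

  monomial : ∀ {m} (f : PExpPoly F m) → Fin (PExpPoly.e f) → (Fin m → ℤ) → Carrier
  monomial {m} f j x = product (λ i → base i ^ linForm F m (form i j) x)
    where open PExpPoly f

  evalPExp≡sum : ∀ {m} (f : PExpPoly F m) x →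
                 evalPExp F f x ≡ sum (λ j → PExpPoly.coeff f j * monomial f j x)
  evalPExp≡sum {m} f x = ≡.trans (sumFin≡sum e _)
    (sum-cong-≗ λ j → cong (coeff j *_) (prodFin≡product k _))
    where open PExpPoly f

  mapForms : ∀ {m n} → ((Fin m → ℤ) → (Fin n → ℤ)) → PExpPoly F m → PExpPoly F n
  mapForms φ f = record
    { e = e ; k = k ; coeff = coeff ; coeff≉0 = coeff≉0 ; base = base
    ; form = λ i j → φ (form i j) }
    where open PExpPoly f

  evalPExp-mapForms : ∀ {m n} (φ : (Fin m → ℤ) → (Fin n → ℤ)) (f : PExpPoly F m) x y →
    (∀ a → linForm F n (φ a) y ≡ linForm F m a x) → evalPExp F (mapForms φ f) y ≡ evalPExp F f x
  evalPExp-mapForms φ f x y φ-compat = ≡.trans (evalPExp≡sum (mapForms φ f) y)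
    (≡.trans (sum-cong-≗ λ j → cong (coeff j *_) (product-cong-≗ λ i →
                                cong (base i ^_) (φ-compat (form i j))))
             (≡.sym (evalPExp≡sum f x)))
    where open PExpPoly f

  evalPExp-cong : ∀ {m} (f : PExpPoly F m) {x y} → x ≗ y → evalPExp F f x ≡ evalPExp F f y
  evalPExp-cong {m} f {x} {y} x≗y =
    evalPExp-mapForms id f y x (λ a → linForm-cong m a x≗y)

  *-distribˡ-evalPExp : ∀ {m} u (f : PExpPoly F m) x →
    u * evalPExp F f x ≈ sum (λ j → u * (PExpPoly.coeff f j * monomial f j x))
  *-distribˡ-evalPExp u f x =
    trans (*-congˡ (reflexive (evalPExp≡sum f x)))
          (*-distribˡ-sum u (λ j → PExpPoly.coeff f j * monomial f j x))

  val*x≈0⇒x≈0 : ∀ (d : NonZeroElt F) {x} → val d * x ≈ 0# → x ≈ 0#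
  val*x≈0⇒x≈0 d {x} dx≈0 = begin
    x                    ≈⟨ *-identityˡ x ⟨
    1# * x               ≈⟨ *-congʳ (val*inv d) ⟨
    (val d * inv d) * x  ≈⟨ *-congʳ (*-comm _ _) ⟩
    (inv d * val d) * x  ≈⟨ *-assoc _ _ _ ⟩
    inv d * (val d * x)  ≈⟨ *-congˡ dx≈0 ⟩
    inv d * 0#           ≈⟨ zeroʳ _ ⟩
    0#                   ∎

  scale : ∀ {m} → NonZeroElt F → PExpPoly F m → PExpPoly F m
  scale d f = record f
    { coeff = λ j → val d * coeff j
    ; coeff≉0 = λ j → coeff≉0 j ∘ val*x≈0⇒x≈0 d }
    where open PExpPoly f

  evalPExp-scale : ∀ {m} d (f : PExpPoly F m) x →
                   evalPExp F (scale d f) x ≈ val d * evalPExp F f x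
  evalPExp-scale d f x = begin
    evalPExp F (scale d f) x                         ≡⟨ evalPExp≡sum (scale d f) x ⟩
    sum (λ j → (val d * coeff j) * monomial f j x)  ≈⟨ sum-cong-≋ (λ j → *-assoc (val d) (coeff j) _) ⟩
    sum (λ j → val d * (coeff j * monomial f j x))  ≈⟨ *-distribˡ-evalPExp (val d) f x ⟨
    val d * evalPExp F f x                           ∎
    where open PExpPoly f

  twist : ∀ {m} → NonZeroElt F → (Fin m → ℤ) → PExpPoly F m → PExpPoly F m
  twist μ l f = record
    { e = e ; k = suc k ; coeff = coeff ; coeff≉0 = coeff≉0
    ; base = μ ∷ base ; form = (λ _ → l) ∷ form }
    where open PExpPoly f

  evalPExp-twist : ∀ {m} μ (l : Fin m → ℤ) (f : PExpPoly F m) x →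
    evalPExp F (twist μ l f) x ≈ (μ ^ linForm F m l x) * evalPExp F f x
  evalPExp-twist {m} μ l f x = begin
    evalPExp F (twist μ l f) x                   ≡⟨ evalPExp≡sum (twist μ l f) x ⟩
    sum (λ j → coeff j * (u * monomial f j x))  ≈⟨ sum-cong-≋ (λ j → x∙yz≈y∙xz (coeff j) u _) ⟩
    sum (λ j → u * (coeff j * monomial f j x))  ≈⟨ *-distribˡ-evalPExp u f x ⟨
    u * evalPExp F f x                           ∎
    where open PExpPoly f
          u : Carrier
          u = μ ^ linForm F m l x

  blockForms : ∀ {m k₁ k₂ e₁ e₂} →
    (Fin k₁ → Fin e₁ → Fin m → ℤ) → (Fin k₂ → Fin e₂ → Fin m → ℤ) →
    Fin k₁ ⊎ Fin k₂ → Fin e₁ ⊎ Fin e₂ → Fin m → ℤ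
  blockForms form₁ form₂ (inj₁ i) (inj₁ j) = form₁ i j
  blockForms form₁ form₂ (inj₂ i) (inj₂ j) = form₂ i j
  blockForms {m} form₁ form₂ _ _ = replicate m 0ℤ

  infixl 6 _⊕_
  _⊕_ : ∀ {m} → PExpPoly F m → PExpPoly F m → PExpPoly F m
  f ⊕ g = record
    { e = f.e ℕ.+ g.e
    ; k = f.k ℕ.+ g.k
    ; coeff = f.coeff ++ g.coeff
    ; coeff≉0 = λ j → Sum.[_,_] {C = λ s → ¬ (Sum.[ f.coeff , g.coeff ] s ≈ 0#)}
                        f.coeff≉0 g.coeff≉0 (splitAt f.e j)
    ; base = f.base ++ g.base
    ; form = λ i j → blockForms f.form g.form (splitAt f.k i) (splitAt f.e j) }
    where module f = PExpPoly f
          module g = PExpPoly g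

  product-^-zeroForm : ∀ {m} n (bs : Fin n → NonZeroElt F) x →
                       product (λ i → bs i ^ linForm F m (replicate m 0ℤ) x) ≈ 1#
  product-^-zeroForm {m} n bs x =
    trans (product-cong-≋ λ i → reflexive (cong (bs i ^_) (linForm-zero m x)))
          (product-replicate-one n)

  evalPExp-⊕ : ∀ {m} (f g : PExpPoly F m) x →
               evalPExp F (f ⊕ g) x ≈ evalPExp F f x + evalPExp F g x
  evalPExp-⊕ {m} f g x = begin
    evalPExp F (f ⊕ g) x                   ≡⟨ evalPExp≡sum (f ⊕ g) x ⟩
    sum (term ∘ splitAt f.e)               ≈⟨ sum-splitAt +-monoid f.e term ⟩
    sum (term ∘ inj₁) + sum (term ∘ inj₂)  ≈⟨ +-cong (sum-cong-≋ termˡ) (sum-cong-≋ termʳ) ⟩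
    sum (λ j → f.coeff j * monomial f j x) + sum (λ j → g.coeff j * monomial g j x)
                                           ≡⟨ cong₂ _+_ (evalPExp≡sum f x) (evalPExp≡sum g x) ⟨
    evalPExp F f x + evalPExp F g x        ∎
    where
      module f = PExpPoly f
      module g = PExpPoly g
      factor : Fin f.e ⊎ Fin g.e → Fin f.k ⊎ Fin g.k → Carrier
      factor s t = Sum.[ f.base , g.base ] t ^ linForm F m (blockForms f.form g.form t s) x
      term : Fin f.e ⊎ Fin g.e → Carrier
      term s = Sum.[ f.coeff , g.coeff ] s * product (factor s ∘ splitAt f.k)
      termˡ : ∀ j → term (inj₁ j) ≈ f.coeff j * monomial f j x
      termˡ j = *-congˡ (begin
        product (factor (inj₁ j) ∘ splitAt f.k)  ≈⟨ sum-splitAt *-monoid f.k (factor (inj₁ j)) ⟩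
        monomial f j x * _                      ≈⟨ *-congˡ (product-^-zeroForm g.k g.base x) ⟩
        monomial f j x * 1#                     ≈⟨ *-identityʳ _ ⟩
        monomial f j x                          ∎)
      termʳ : ∀ j → term (inj₂ j) ≈ g.coeff j * monomial g j x
      termʳ j = *-congˡ (begin
        product (factor (inj₂ j) ∘ splitAt f.k)  ≈⟨ sum-splitAt *-monoid f.k (factor (inj₂ j)) ⟩
        _ * monomial g j x                      ≈⟨ *-congʳ (product-^-zeroForm f.k f.base x) ⟩
        1# * monomial g j x                     ≈⟨ *-identityˡ _ ⟩
        monomial g j x                          ∎)

  leftBlock : ∀ m n → (Fin (suc (m ℕ.+ n)) → ℤ) → Fin m → ℤ
  leftBlock m n z = tail z ∘ (_↑ˡ n)

  rightBlock : ∀ m n → (Fin (suc (m ℕ.+ n)) → ℤ) → Fin n → ℤ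
  rightBlock m n z = tail z ∘ (m ↑ʳ_)

  leftBlockForm : ∀ {m} n → (Fin m → ℤ) → Fin (suc (m ℕ.+ n)) → ℤ
  leftBlockForm n a = 0ℤ ∷ (a ++ replicate n 0ℤ)

  rightBlockForm : ∀ m {n} → (Fin n → ℤ) → Fin (suc (m ℕ.+ n)) → ℤ
  rightBlockForm m a = 0ℤ ∷ (replicate m 0ℤ ++ a)

  linForm-leftBlockForm : ∀ {m} n (a : Fin m → ℤ) z →
    linForm F (suc (m ℕ.+ n)) (leftBlockForm n a) z ≡ linForm F m a (leftBlock m n z)
  linForm-leftBlockForm {m} n a z =
    ≡.trans (ℤₚ.+-identityˡ _)
    (≡.trans (linForm-splitAt m n Sum.[ a , replicate n 0ℤ ] (tail z))
    (≡.trans (cong (λ i → linForm F m a (leftBlock m n z) ℤ.+ i) (linForm-zero n _))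
             (ℤₚ.+-identityʳ _)))

  linForm-rightBlockForm : ∀ m {n} (a : Fin n → ℤ) z →
    linForm F (suc (m ℕ.+ n)) (rightBlockForm m a) z ≡ linForm F n a (rightBlock m n z)
  linForm-rightBlockForm m {n} a z =
    ≡.trans (ℤₚ.+-identityˡ _)
    (≡.trans (linForm-splitAt m n Sum.[ replicate m 0ℤ , a ] (tail z))
    (≡.trans (cong (λ i → i ℤ.+ linForm F n a (rightBlock m n z)) (linForm-zero m _))
             (ℤₚ.+-identityˡ _)))

  onLeftBlock : ∀ {m} n → PExpPoly F m → PExpPoly F (suc (m ℕ.+ n))
  onLeftBlock n = mapForms (leftBlockForm n)

  onRightBlock : ∀ m {n} → PExpPoly F n → PExpPoly F (suc (m ℕ.+ n))
  onRightBlock m = mapForms (rightBlockForm m)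

  evalPExp-onLeftBlock : ∀ {m} n (f : PExpPoly F m) z →
    evalPExp F (onLeftBlock n f) z ≡ evalPExp F f (leftBlock m n z)
  evalPExp-onLeftBlock n f z =
    evalPExp-mapForms (leftBlockForm n) f _ z (λ a → linForm-leftBlockForm n a z)

  evalPExp-onRightBlock : ∀ m {n} (g : PExpPoly F n) z →
    evalPExp F (onRightBlock m g) z ≡ evalPExp F g (rightBlock m n z)
  evalPExp-onRightBlock m g z =
    evalPExp-mapForms (rightBlockForm m) g _ z (λ a → linForm-rightBlockForm m a z)

  headForm : ∀ m → Fin (suc m) → ℤ
  headForm m = 1ℤ ∷ replicate m 0ℤ

  linForm-headForm : ∀ m (z : Fin (suc m) → ℤ) → linForm F (suc m) (headForm m) z ≡ head z
  linForm-headForm m z =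
    ≡.trans (cong₂ ℤ._+_ (ℤₚ.*-identityˡ (head z)) (linForm-zero m (tail z))) (ℤₚ.+-identityʳ _)

  -1*-1≈1 : - 1# * - 1# ≈ 1#
  -1*-1≈1 = trans (-1*x≈-x (- 1#)) (-‿involutive 1#)

  minusOne : NonZeroElt F
  minusOne = nz (- 1#) (- 1#) -1*-1≈1

  -1^ⁿ-sign : ∀ n → _^ⁿ_ F (- 1#) n ≈ 1# ⊎ _^ⁿ_ F (- 1#) n ≈ - 1#
  -1^ⁿ-sign zero = inj₁ refl
  -1^ⁿ-sign (suc n) with -1^ⁿ-sign n
  ... | inj₁ ≈1  = inj₂ (trans (*-congˡ ≈1) (*-identityʳ _))
  ... | inj₂ ≈-1 = inj₁ (trans (*-congˡ ≈-1) -1*-1≈1)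

  minusOne^-sign : ∀ z → minusOne ^ z ≈ 1# ⊎ minusOne ^ z ≈ - 1#
  minusOne^-sign (ℤ.+ n)    = -1^ⁿ-sign n
  minusOne^-sign ℤ.-[1+ n ] = -1^ⁿ-sign (suc n)

  module Selector (half : Carrier) (half+half≈1 : half + half ≈ 1#) where

    halfUnit : NonZeroElt F
    halfUnit = nz half (1# + 1#)
      (trans (distribˡ half 1# 1#)
             (trans (+-cong (*-identityʳ half) (*-identityʳ half)) half+half≈1))

    half*[x+x]≈x : ∀ x → half * (x + x) ≈ x
    half*[x+x]≈x x = begin
      half * (x + x)       ≈⟨ distribˡ half x x ⟩
      half * x + half * x  ≈⟨ distribʳ x half half ⟨
      (half + half) * x    ≈⟨ *-congʳ half+half≈1 ⟩
      1# * x               ≈⟨ *-identityˡ x ⟩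
      x                    ∎

    module _ {m n} (f : PExpPoly F m) (g : PExpPoly F n) where
      private
        t : Fin (suc (m ℕ.+ n)) → ℤ
        t = headForm (m ℕ.+ n)
        L R L⁺ R⁻ : PExpPoly F (suc (m ℕ.+ n))
        L = onLeftBlock n f
        R = onRightBlock m g
        L⁺ = L ⊕ twist minusOne t L
        R⁻ = R ⊕ scale minusOne (twist minusOne t R)

      select : PExpPoly F (suc (m ℕ.+ n))
      select = scale halfUnit (L⁺ ⊕ R⁻)

      module _ (z : Fin (suc (m ℕ.+ n)) → ℤ) where
        private
          a b ε : Carrier
          a = evalPExp F f (leftBlock m n z)
          b = evalPExp F g (rightBlock m n z)
          ε = minusOne ^ head z

          L≈a : evalPExp F L z ≈ a
          L≈a = reflexive (evalPExp-onLeftBlock n f z)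
          R≈b : evalPExp F R z ≈ b
          R≈b = reflexive (evalPExp-onRightBlock m g z)
          twist≈ε* : ∀ P {c} → evalPExp F P z ≈ c → evalPExp F (twist minusOne t P) z ≈ ε * c
          twist≈ε* P P≈c = trans (evalPExp-twist minusOne t P z)
            (*-cong (reflexive (cong (minusOne ^_) (linForm-headForm (m ℕ.+ n) z))) P≈c)

        evalPExp-select : evalPExp F select z ≈ half * ((a + ε * a) + (b + - 1# * (ε * b)))
        evalPExp-select = trans (evalPExp-scale halfUnit (L⁺ ⊕ R⁻) z) (*-congˡ (begin
          evalPExp F (L⁺ ⊕ R⁻) z             ≈⟨ evalPExp-⊕ L⁺ R⁻ z ⟩
          evalPExp F L⁺ z + evalPExp F R⁻ z
            ≈⟨ +-cong (trans (evalPExp-⊕ L (twist minusOne t L) z) (+-cong L≈a (twist≈ε* L L≈a)))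
                      (trans (evalPExp-⊕ R (scale minusOne (twist minusOne t R)) z)
                             (+-cong R≈b (trans (evalPExp-scale minusOne (twist minusOne t R) z)
                                                (*-congˡ (twist≈ε* R R≈b))))) ⟩
          (a + ε * a) + (b + - 1# * (ε * b)) ∎))

        evalPExp-select-even : ε ≈ 1# → evalPExp F select z ≈ a
        evalPExp-select-even ε≈1 = begin
          evalPExp F select z                          ≈⟨ evalPExp-select ⟩
          half * ((a + ε * a) + (b + - 1# * (ε * b)))  ≈⟨ *-congˡ (+-cong (+-congˡ (ε*x≈x a)) b-b≈0) ⟩
          half * ((a + a) + 0#)                        ≈⟨ *-congˡ (+-identityʳ _) ⟩
          half * (a + a)                               ≈⟨ half*[x+x]≈x a ⟩
          a                                            ∎
          where
            ε*x≈x : ∀ x → ε * x ≈ x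
            ε*x≈x x = trans (*-congʳ ε≈1) (*-identityˡ x)
            b-b≈0 : b + - 1# * (ε * b) ≈ 0#
            b-b≈0 = trans (+-congˡ (trans (*-congˡ (ε*x≈x b)) (-1*x≈-x b))) (-‿inverseʳ b)

        evalPExp-select-odd : ε ≈ - 1# → evalPExp F select z ≈ b
        evalPExp-select-odd ε≈-1 = begin
          evalPExp F select z                          ≈⟨ evalPExp-select ⟩
          half * ((a + ε * a) + (b + - 1# * (ε * b)))  ≈⟨ *-congˡ (+-cong a-a≈0 (+-congˡ b≈b)) ⟩
          half * (0# + (b + b))                        ≈⟨ *-congˡ (+-identityˡ _) ⟩
          half * (b + b)                               ≈⟨ half*[x+x]≈x b ⟩
          b                                            ∎
          where
            ε*x≈-x : ∀ x → ε * x ≈ - x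
            ε*x≈-x x = trans (*-congʳ ε≈-1) (-1*x≈-x x)
            a-a≈0 : a + ε * a ≈ 0#
            a-a≈0 = trans (+-congˡ (ε*x≈-x a)) (-‿inverseʳ a)
            b≈b : - 1# * (ε * b) ≈ b
            b≈b = trans (-1*x≈-x _) (trans (-‿cong (ε*x≈-x b)) (-‿involutive b))

  AdmitsPExpParam-resp : ∀ {p q r} {S : (Fin r → Carrier) → Set p} {T : (Fin r → Carrier) → Set q} →
    (∀ v → S v → T v) → (∀ v → T v → S v) → AdmitsPExpParam F r S → AdmitsPExpParam F r T
  AdmitsPExpParam-resp S⊆T T⊆S (m , f , S≡im) =
    m , f , λ v → proj₁ (S≡im v) ∘ T⊆S v , S⊆T v ∘ proj₂ (S≡im v)

  AdmitsPExpParam-∪ : ∀ {p r} {S T : (Fin r → Carrier) → Set p} → ∃[ h ] (h + h ≈ 1#) →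
    AdmitsPExpParam F r S → AdmitsPExpParam F r T → AdmitsPExpParam F r (λ v → S v ⊎ T v)
  AdmitsPExpParam-∪ {r = r} {S} {T} (half , half+half≈1) (m , f , S≡im) (n , g , T≡im) =
    suc (m ℕ.+ n) , h , λ v → Sum.[ fromS ∘ proj₁ (S≡im v) , fromT ∘ proj₁ (T≡im v) ] , toS∪T
    where
      open Selector half half+half≈1
      h : Fin r → PExpPoly F (suc (m ℕ.+ n))
      h i = select (f i) (g i)

      InImage : ∀ {M} → (Fin r → PExpPoly F M) → (Fin r → Carrier) → Set ℓ
      InImage P v = ∃[ x ] (∀ i → v i ≈ evalPExp F (P i) x)

      fromS : ∀ {v} → InImage f v → InImage h v
      fromS (x , v≈fx) = z , λ i → trans (v≈fx i) (sym (
        trans (evalPExp-select-even (f i) (g i) z refl)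
              (reflexive (evalPExp-cong (f i) (lookup-++ˡ x (replicate n 0ℤ))))))
        where z : Fin (suc (m ℕ.+ n)) → ℤ
              z = 0ℤ ∷ (x ++ replicate n 0ℤ)

      fromT : ∀ {v} → InImage g v → InImage h v
      fromT (y , v≈gy) = z , λ i → trans (v≈gy i) (sym (
        trans (evalPExp-select-odd (f i) (g i) z (*-identityʳ (- 1#)))
              (reflexive (evalPExp-cong (g i) (lookup-++ʳ (replicate m 0ℤ) y)))))
        where z : Fin (suc (m ℕ.+ n)) → ℤ
              z = 1ℤ ∷ (replicate m 0ℤ ++ y)

      toS∪T : ∀ {v} → InImage h v → S v ⊎ T v
      toS∪T {v} (z , v≈hz) with minusOne^-sign (head z)
      ... | inj₁ even = inj₁ (proj₂ (S≡im v)
              (leftBlock m n z , λ i → trans (v≈hz i) (evalPExp-select-even (f i) (g i) z even)))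
      ... | inj₂ odd  = inj₂ (proj₂ (T≡im v)
              (rightBlock m n z , λ i → trans (v≈hz i) (evalPExp-select-odd (f i) (g i) z odd)))

  AdmitsPExpParam-⋃ : ∀ {p r} → ∃[ h ] (h + h ≈ 1#) →
    ∀ s (S : Fin (suc s) → (Fin r → Carrier) → Set p) →
    (∀ i → AdmitsPExpParam F r (S i)) → AdmitsPExpParam F r (λ v → ∃[ i ] S i v)
  AdmitsPExpParam-⋃ ½ zero S adm =
    AdmitsPExpParam-resp (λ _ v∈S → zero , v∈S) (λ { _ (zero , v∈S) → v∈S }) (adm zero)
  AdmitsPExpParam-⋃ ½ (suc s) S adm =
    AdmitsPExpParam-resp
      (λ _ → Sum.[ (zero ,_) , Product.map suc id ])
      (λ { _ (zero , v∈S) → inj₁ v∈S ; _ (suc i , v∈S) → inj₂ (i , v∈S) })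
      (AdmitsPExpParam-∪ ½ (adm zero) (AdmitsPExpParam-⋃ ½ s (S ∘ suc) (adm ∘ suc)))

proposition4p3 : ∀ {c ℓ p} (F : CommutativeRing c ℓ) → IsFieldCR F → CharZero F → AlgClosed F →
    (r s : ℕ) (S : Fin (suc s) → (Fin r → CommutativeRing.Carrier F) → Set p) →
    (∀ i → AdmitsPExpParam F r (S i)) →
    AdmitsPExpParam F r (λ v → ∃[ i ] S i v)
proposition4p3 F isField charZero _ r s = AdmitsPExpParam-⋃ F (half , half+half≈1) s
  where
    open CommutativeRing F
    open IsFieldCR isField using (inverse)
    two≉0 : ¬ (1# + 1# ≈ 0#)
    two≉0 = charZero 1 ∘ trans (+-congˡ (+-identityʳ 1#))
    half : Carrier
    half = proj₁ (inverse (1# + 1#) two≉0)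
    half+half≈1 : half + half ≈ 1#
    half+half≈1 = trans (sym (+-cong (*-identityˡ half) (*-identityˡ half)))
      (trans (sym (distribʳ half 1# 1#)) (proj₂ (inverse (1# + 1#) two≉0)))
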